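{- Let $(\mu,k)$ be a spherical profile, i.e. $\mu=[1^{\mu_1},2^{\mu_2},\dots]$ is an integer partition and $k$ an integer with $\sum_i\mu_i(i-2)=k-4$, and assume $k\ge2$. Then there exists a decorated plane tree with profile $(\mu,k-2)$.
   Context: A decorated plane tree is a pair $(T,L)$ with $T$ a tree embedded in the sphere and $L$ a subset of the leaves of $T$. It has profile $(\mu,\ell)$ if $|L|=\ell$ and for each $i$, $\mu_i$ is the number of vertices of $T$ not in $L$ that have degree $i$. -}

module Defs where

open import Data.Nat using (ℕ; zero; suc; _+_; _≤_)
open import Data.Integer as ℤ using (ℤ; +_)
open import Data.List using (List; []; _∷_; _++_; length; map; filter; foldr)
open import Data.Product using (_×_)
open import Data.List.Relation.Unary.All using (All)
open import Data.Nat using (_≟_)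
open import Relation.Binary.PropositionalEquality using (_≡_)

-- Plane trees are encoded combinatorially, rooted at an oriented edge
-- (root edge + cyclic order of neighbours at each vertex = list order
-- of children).  A "Sub" is the part of the tree hanging below an edge,
-- seen from its parent end.
--   decL      : the child is a leaf belonging to the decoration set L
--   node cs   : the child is a vertex NOT in L, whose further neighbours
--               (children), in cyclic order after the parent, are cs;
--               its degree is  1 + length cs.
data Sub : Set where
  decL : Sub
  node : List Sub → Sub

-- A decorated plane tree (T , L): root edge joining the roots of two Subs.
record DecoratedPlaneTree : Set where
  constructor _—_
  field
    end₁ : Sub
    end₂ : Sub

mutual
  degsS : Sub → List ℕ
  degsS decL      = []
  degsS (node cs) = suc (length cs) ∷ degsL cs

  degsL : List Sub → List ℕ
  degsL []       = []
  degsL (c ∷ cs) = degsS c ++ degsL cs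

mutual
  marksS : Sub → ℕ
  marksS decL      = 1
  marksS (node cs) = marksL cs

  marksL : List Sub → ℕ
  marksL []       = 0
  marksL (c ∷ cs) = marksS c + marksL cs

nonLDegrees : DecoratedPlaneTree → List ℕ
nonLDegrees (a — b) = degsS a ++ degsS b

|L| : DecoratedPlaneTree → ℕ
|L| (a — b) = marksS a + marksS b

mult : ℕ → List ℕ → ℕ
mult i xs = length (filter (i ≟_) xs)

-- An integer partition μ given as the list of its parts (all ≥ 1);
-- μ_i = mult i μ.
IsPartition : List ℕ → Set
IsPartition μ = All (1 ≤_) μ

sphericalSum : List ℕ → ℤ
sphericalSum μ = foldr ℤ._+_ (+ 0) (map (λ p → + p ℤ.- + 2) μ)

IsSphericalProfile : List ℕ → ℤ → Set
IsSphericalProfile μ k = IsPartition μ × (sphericalSum μ ≡ k ℤ.- + 4)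

HasProfile : DecoratedPlaneTree → List ℕ → ℕ → Set
HasProfile t μ ℓ = (|L| t ≡ ℓ) × (∀ i → mult i (nonLDegrees t) ≡ mult i μ)

-- Split μ into its parts equal to 1 and its parts 2 + q.  Take a path whose inner
-- vertices have the degrees 2 + q, hang q pendant leaves on the vertex of degree
-- 2 + q, and one more leaf at each end of the path.  This needs 2 + Σ q leaves,
-- and the spherical condition says that this is exactly μ₁ + (k - 2): the μ₁
-- unmarked leaves plus the k - 2 leaves in L.
module Submission where

open import Defs
open import Data.List using (List)
open import Data.Nat using (ℕ)
open import Data.Integer using (ℤ; +_; _-_; _≤_)
open import Data.Product using (Σ; _×_)
open import Relation.Binary.PropositionalEquality using (_≡_)

open import Data.List using ([]; _∷_; _++_; length; map; concat; take; drop; replicate)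
open import Data.List.Properties using (length-take; length-drop; take++drop≡id; length-replicate)
import Data.List.Properties as List
open import Data.List.Relation.Binary.Permutation.Propositional
  using (_↭_; ↭-refl; ↭-prep; ↭-sym; ↭-trans; module PermutationReasoning)
open import Data.List.Relation.Binary.Permutation.Propositional.Properties
  using (↭-length; filter-↭; ++⁺ˡ; ++⁺ʳ; ++-comm; ++-assoc; ++-identityʳ; shift; shifts)
open import Data.List.Relation.Unary.All using ([]; _∷_)
open import Data.Nat using (zero; suc; _+_; _∸_; _≟_; z≤n; s≤s) renaming (_≤_ to _≤ℕ_)
open import Data.Nat.ListAction using (sum)
open import Data.Nat.Properties
  using (+-comm; +-assoc; +-identityʳ; suc-injective; m≤m+n; m≤n+m; m+n∸m≡n; m+n∸n≡m; m≤n⇒m⊓n≡m)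
open import Data.Integer using (_⊖_; -[1+_]; +≤+) renaming (_+_ to _+ℤ_)
import Data.Integer.Properties as ℤₚ
open import Data.Product using (_,_)
open import Relation.Binary.PropositionalEquality
  using (refl; sym; trans; cong; cong₂; subst; module ≡-Reasoning)

mult-↭ : ∀ i {xs ys : List ℕ} → xs ↭ ys → mult i xs ≡ mult i ys
mult-↭ i xs↭ys = ↭-length (filter-↭ (i ≟_) xs↭ys)

m⊖n+n≡m : ∀ m n → m ⊖ n +ℤ + n ≡ + m
m⊖n+n≡m m n = begin
  m ⊖ n +ℤ + n  ≡⟨ ℤₚ.distribˡ-⊖-+-pos n m n ⟩
  (m + n) ⊖ n   ≡⟨ ℤₚ.⊖-≥ (m≤n+m n m) ⟩
  + (m + n ∸ n) ≡⟨ cong +_ (m+n∸n≡m m n) ⟩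
  + m           ∎
  where open ≡-Reasoning

m⊖n≡p⊖q⇒m+q≡p+n : ∀ {m n p q} → m ⊖ n ≡ p ⊖ q → m + q ≡ p + n
m⊖n≡p⊖q⇒m+q≡p+n {m} {n} {p} {q} eq = ℤₚ.+-injective (begin
  + m +ℤ + q               ≡⟨ cong (_+ℤ + q) (m⊖n+n≡m m n) ⟨
  m ⊖ n +ℤ + n +ℤ + q      ≡⟨ ℤₚ.+-assoc (m ⊖ n) (+ n) (+ q) ⟩
  m ⊖ n +ℤ + (n + q)       ≡⟨ cong₂ _+ℤ_ eq (cong +_ (+-comm n q)) ⟩
  p ⊖ q +ℤ + (q + n)       ≡⟨ ℤₚ.+-assoc (p ⊖ q) (+ q) (+ n) ⟨
  p ⊖ q +ℤ + q +ℤ + n      ≡⟨ cong (_+ℤ + n) (m⊖n+n≡m p q) ⟩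
  + p +ℤ + n               ∎)
  where open ≡-Reasoning

split-into-lengths : ∀ {A : Set} (qs : List ℕ) (xs : List A) → length xs ≡ sum qs →
  Σ (List (List A)) (λ xss → map length xss ≡ qs × concat xss ≡ xs)
split-into-lengths []       []  _   = [] , refl , refl
split-into-lengths (q ∷ qs) xs len
  with split-into-lengths qs (drop q xs)
         (trans (length-drop q xs) (trans (cong (_∸ q) len) (m+n∸m≡n q (sum qs))))
... | xss , lengths , concat≡ =
  take q xs ∷ xss ,
  cong₂ _∷_ length-take-q lengths ,
  trans (cong (take q xs ++_) concat≡) (take++drop≡id q xs)
  where
  length-take-q : length (take q xs) ≡ q
  length-take-q =
    trans (length-take q xs) (m≤n⇒m⊓n≡m (subst (q ≤ℕ_) (sym len) (m≤m+n q (sum qs))))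

degsL-++ : ∀ cs ds → degsL (cs ++ ds) ≡ degsL cs ++ degsL ds
degsL-++ []       ds = refl
degsL-++ (c ∷ cs) ds =
  trans (cong (degsS c ++_) (degsL-++ cs ds)) (sym (List.++-assoc (degsS c) (degsL cs) (degsL ds)))

marksL-++ : ∀ cs ds → marksL (cs ++ ds) ≡ marksL cs + marksL ds
marksL-++ []       ds = refl
marksL-++ (c ∷ cs) ds =
  trans (cong (_+_ (marksS c)) (marksL-++ cs ds)) (sym (+-assoc (marksS c) (marksL cs) (marksL ds)))

caterpillar : List (List Sub) → Sub → Sub
caterpillar []         e = e
caterpillar (ps ∷ pss) e = node (caterpillar pss e ∷ ps)

degsS-caterpillar : ∀ pss e →
  degsS (caterpillar pss e) ↭ map (_+_ 2) (map length pss) ++ degsS e ++ degsL (concat pss)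
degsS-caterpillar []         e = ↭-sym (++-identityʳ (degsS e))
degsS-caterpillar (ps ∷ pss) e = ↭-prep (2 + length ps) (begin
  degsS (caterpillar pss e) ++ P  ↭⟨ ++⁺ʳ P (degsS-caterpillar pss e) ⟩
  (M ++ D ++ C) ++ P              ↭⟨ ++-assoc M (D ++ C) P ⟩
  M ++ (D ++ C) ++ P              ↭⟨ ++⁺ˡ M (++-assoc D C P) ⟩
  M ++ D ++ C ++ P                ↭⟨ ++⁺ˡ M (++⁺ˡ D (++-comm C P)) ⟩
  M ++ D ++ P ++ C                ≡⟨ cong (λ xs → M ++ D ++ xs) (degsL-++ ps (concat pss)) ⟨
  M ++ D ++ degsL (ps ++ concat pss) ∎)
  where
  open PermutationReasoning
  M = map (_+_ 2) (map length pss)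
  D = degsS e
  C = degsL (concat pss)
  P = degsL ps

marksS-caterpillar : ∀ pss e → marksS (caterpillar pss e) ≡ marksS e + marksL (concat pss)
marksS-caterpillar []         e = sym (+-identityʳ (marksS e))
marksS-caterpillar (ps ∷ pss) e = begin
  marksS (caterpillar pss e) + marksL ps          ≡⟨ cong (_+ marksL ps) (marksS-caterpillar pss e) ⟩
  (marksS e + marksL (concat pss)) + marksL ps    ≡⟨ +-assoc (marksS e) _ (marksL ps) ⟩
  marksS e + (marksL (concat pss) + marksL ps)    ≡⟨ cong (_+_ (marksS e)) (+-comm (marksL (concat pss)) (marksL ps)) ⟩
  marksS e + (marksL ps + marksL (concat pss))    ≡⟨ cong (_+_ (marksS e)) (marksL-++ ps (concat pss)) ⟨
  marksS e + marksL (ps ++ concat pss)            ∎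
  where open ≡-Reasoning

caterpillarTree : ∀ qs (pool : List Sub) → length pool ≡ 2 + sum qs →
  Σ DecoratedPlaneTree (λ t → (nonLDegrees t ↭ map (_+_ 2) qs ++ degsL pool) × (|L| t ≡ marksL pool))
caterpillarTree qs (e₁ ∷ e₂ ∷ rest) len
  with split-into-lengths qs rest (suc-injective (suc-injective len))
... | pss , refl , refl =
  e₁ — caterpillar pss e₂ , degrees , cong (_+_ (marksS e₁)) (marksS-caterpillar pss e₂)
  where
  degrees : degsS e₁ ++ degsS (caterpillar pss e₂)
              ↭ map (_+_ 2) (map length pss) ++ degsL (e₁ ∷ e₂ ∷ concat pss)
  degrees = ↭-trans (++⁺ˡ (degsS e₁) (degsS-caterpillar pss e₂))
                    (shifts (degsS e₁) (map (_+_ 2) (map length pss)))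

ones : List ℕ → ℕ
ones []             = 0
ones (suc zero ∷ μ) = suc (ones μ)
ones (_ ∷ μ)        = ones μ

excesses : List ℕ → List ℕ
excesses []                = []
excesses (suc (suc q) ∷ μ) = q ∷ excesses μ
excesses (_ ∷ μ)           = excesses μ

↭-excesses++ones : ∀ {μ} → IsPartition μ → μ ↭ map (_+_ 2) (excesses μ) ++ replicate (ones μ) 1
↭-excesses++ones []                             = ↭-refl
↭-excesses++ones {suc zero ∷ μ}    (_ ∷ parts) =
  ↭-trans (↭-prep 1 (↭-excesses++ones parts)) (↭-sym (shift 1 (map (_+_ 2) (excesses μ)) _))
↭-excesses++ones {suc (suc q) ∷ μ} (_ ∷ parts) = ↭-prep (2 + q) (↭-excesses++ones parts)

sphericalSum≡sum-excesses⊖ones : ∀ {μ} → IsPartition μ →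
  sphericalSum μ ≡ sum (excesses μ) ⊖ ones μ
sphericalSum≡sum-excesses⊖ones []                             = refl
sphericalSum≡sum-excesses⊖ones {suc zero ∷ μ}    (_ ∷ parts) =
  trans (cong (_+ℤ_ -[1+ 0 ]) (sphericalSum≡sum-excesses⊖ones parts))
        (ℤₚ.distribʳ-⊖-+-neg 0 (sum (excesses μ)) (ones μ))
sphericalSum≡sum-excesses⊖ones {suc (suc q) ∷ μ} (_ ∷ parts) =
  trans (cong (_+ℤ_ (+ q)) (sphericalSum≡sum-excesses⊖ones parts))
        (ℤₚ.distribʳ-⊖-+-pos q (sum (excesses μ)) (ones μ))

spherical⇒l+ones≡2+sum-excesses : ∀ {μ l} → IsSphericalProfile μ (+ (2 + l)) →
  l + ones μ ≡ 2 + sum (excesses μ)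
spherical⇒l+ones≡2+sum-excesses {μ} {l} (parts , spherical) =
  trans (sym (m⊖n≡p⊖q⇒m+q≡p+n {sum (excesses μ)} {ones μ} excess⊖ones≡l⊖2)) (+-comm (sum (excesses μ)) 2)
  where
  excess⊖ones≡l⊖2 : sum (excesses μ) ⊖ ones μ ≡ l ⊖ 2
  excess⊖ones≡l⊖2 = begin
    sum (excesses μ) ⊖ ones μ ≡⟨ sphericalSum≡sum-excesses⊖ones parts ⟨
    sphericalSum μ            ≡⟨ spherical ⟩
    + (2 + l) - + 4           ≡⟨ ℤₚ.[+m]-[+n]≡m⊖n (2 + l) 4 ⟩
    (2 + l) ⊖ (2 + 2)         ≡⟨ ℤₚ.+-cancelˡ-⊖ 2 l 2 ⟩
    l ⊖ 2                     ∎
    where open ≡-Reasoning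

leaves : ℕ → ℕ → List Sub
leaves l a = replicate l decL ++ replicate a (node [])

length-leaves : ∀ l a → length (leaves l a) ≡ l + a
length-leaves zero    a = length-replicate a
length-leaves (suc l) a = cong suc (length-leaves l a)

degsL-leaves : ∀ l a → degsL (leaves l a) ≡ replicate a 1
degsL-leaves zero    zero    = refl
degsL-leaves zero    (suc a) = cong (1 ∷_) (degsL-leaves zero a)
degsL-leaves (suc l) a       = degsL-leaves l a

marksL-leaves : ∀ l a → marksL (leaves l a) ≡ l
marksL-leaves zero    zero    = refl
marksL-leaves zero    (suc a) = marksL-leaves zero a
marksL-leaves (suc l) a       = cong suc (marksL-leaves l a)

lemma3p3 : (μ : List ℕ) (k : ℤ) → IsSphericalProfile μ k → + 2 ≤ k →
    Σ DecoratedPlaneTree (λ t → Σ ℕ (λ ℓ → (+ ℓ ≡ k - + 2) × HasProfile t μ ℓ))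
lemma3p3 μ (+ suc (suc l)) profile@(parts , _) (+≤+ (s≤s (s≤s z≤n)))
  with caterpillarTree (excesses μ) (leaves l (ones μ))
         (trans (length-leaves l (ones μ)) (spherical⇒l+ones≡2+sum-excesses profile))
... | t , degrees , marks =
  t , l , refl , trans marks (marksL-leaves l (ones μ)) , λ i → mult-↭ i degrees↭μ
  where
  degrees↭μ : nonLDegrees t ↭ μ
  degrees↭μ = begin
    nonLDegrees t                                         ↭⟨ degrees ⟩
    map (_+_ 2) (excesses μ) ++ degsL (leaves l (ones μ)) ≡⟨ cong (map (_+_ 2) (excesses μ) ++_)
                                                                  (degsL-leaves l (ones μ)) ⟩
    map (_+_ 2) (excesses μ) ++ replicate (ones μ) 1      ↭⟨ ↭-excesses++ones parts ⟨
    μ                                                     ∎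
    where open PermutationReasoning
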